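{- Let $\ell$ be an odd prime, $\nu\geq1$, $d=\ell^{\nu}$, let $p$ be a prime with $p\equiv1\pmod d$, and let $a\in\mathbf{Z}$. The system $$x\equiv\pm1\pmod d,\qquad x^2-ax+p\equiv0\pmod{d^2}$$ has an integer solution $x$ if and only if $d^2\mid a^2-4p$. -}

module Defs where

-- Completing the square gives 4 (x² - a x + p) = (2x - a)² - (a² - 4p).  If x ≡ ±1 (mod d)
-- is a root modulo d², then p ≡ 1 forces a ≡ ±2 ≡ 2x (mod d), so d² divides (2x - a)² and
-- hence the discriminant.  Conversely, d² is odd, so some x has 2x ≡ a (mod d²); it is a root
-- modulo d² because 4 is invertible.  Moreover a² - 4p ≡ (a - 2)(a + 2) (mod d) and ℓ divides
-- at most one of the factors, so d divides a ∓ 2, i.e. 2x ≡ ±2 and x ≡ ±1 (mod d).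
module Submission where

open import Defs
open import Data.Nat using (ℕ; _^_; _≥_)
open import Data.Nat.Primality using (Prime)
open import Data.Integer using (ℤ; +_; _-_; _+_; _*_)
open import Data.Integer.Divisibility using (_∣_)
open import Data.Product using (∃; _×_)
open import Data.Sum using (_⊎_)
open import Function.Bundles using (_⇔_)
open import Relation.Nullary using (¬_)
open import Relation.Binary.PropositionalEquality using (_≡_)

open import Data.Empty using (⊥-elim)
open import Data.List.Base using (_∷_; [])
open import Data.Nat.Primality
  using (prime⇒irreducible; prime⇒nonZero; prime[2]; ¬prime[1]; euclidsLemma)
open import Data.Product using (_,_)
import Data.Product as Product
open import Data.Sum using (inj₁; inj₂; [_,_])
import Data.Sum as Sum
open import Function.Bundles using (mk⇔)
open import Relation.Nullary using (yes; no)
open import Relation.Binary.PropositionalEquality using (refl; sym; trans; cong; subst; module ≡-Reasoning)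
import Data.Nat as ℕ
import Data.Nat.Properties as ℕ
import Data.Nat.Divisibility as ℕ
open import Algebra.Properties.CommutativeSemigroup ℕ.*-commutativeSemigroup using (x∙yz≈z∙xy)
open import Data.Integer using (-_)
open import Data.Integer.Properties using (abs-*; pos-*; *-comm; *-assoc; *-identityˡ)
-- Signed divisibility is closed under linear combinations; the statement uses the unsigned one.
open import Data.Integer.Divisibility.Signed
  using (divides; ∣ᵤ⇒∣; ∣⇒∣ᵤ; ∣-refl; ∣-trans; ∣m∣n⇒∣m+n; ∣m∣n⇒∣m-n; ∣m⇒∣m*n; ∣n⇒∣m*n; module ∣-Reasoning)
  renaming (_∣_ to _∣ˢ_; _∣?_ to _∣ˢ?_)
open import Data.Integer.Tactic.RingSolver using (solve)

private
  variable
    ℓ m n : ℕ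
    i j u v : ℤ

prime≢2⇒∤2 : Prime ℓ → ¬ ℓ ≡ 2 → ¬ ℓ ℕ.∣ 2
prime≢2⇒∤2 pℓ ℓ≢2 ℓ∣2 with prime⇒irreducible prime[2] ℓ∣2
... | inj₁ refl = ¬prime[1] pℓ
... | inj₂ ℓ≡2  = ℓ≢2 ℓ≡2

prime≢2⇒2∤ : Prime ℓ → ¬ ℓ ≡ 2 → ¬ 2 ℕ.∣ ℓ
prime≢2⇒2∤ pℓ ℓ≢2 2∣ℓ with prime⇒irreducible pℓ 2∣ℓ
... | inj₁ ()
... | inj₂ 2≡ℓ = ℓ≢2 (sym 2≡ℓ)

prime∤⇒∤^ : Prime ℓ → ¬ ℓ ℕ.∣ m → ∀ k → ¬ ℓ ℕ.∣ m ^ k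
prime∤⇒∤^ pℓ ℓ∤m ℕ.zero ℓ∣1 = ¬prime[1] (subst Prime (ℕ.∣1⇒≡1 ℓ∣1) pℓ)
prime∤⇒∤^ {m = m} pℓ ℓ∤m (ℕ.suc k) ℓ∣m^1+k with euclidsLemma m (m ^ k) pℓ ℓ∣m^1+k
... | inj₁ ℓ∣m   = ℓ∤m ℓ∣m
... | inj₂ ℓ∣m^k = prime∤⇒∤^ pℓ ℓ∤m k ℓ∣m^k

2∤⇒2∣+1 : ∀ n → ¬ 2 ℕ.∣ n → 2 ℕ.∣ n ℕ.+ 1
2∤⇒2∣+1 0             2∤0   = ⊥-elim (2∤0 (2 ℕ.∣0))
2∤⇒2∣+1 1             _     = ℕ.∣-refl
2∤⇒2∣+1 (ℕ.suc (ℕ.suc n)) 2∤2+n =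
  ℕ.∣m∣n⇒∣m+n ℕ.∣-refl (2∤⇒2∣+1 n (λ 2∣n → 2∤2+n (ℕ.∣m∣n⇒∣m+n ℕ.∣-refl 2∣n)))

prime-power-divisor : Prime ℓ → ¬ ℓ ℕ.∣ m → ∀ k → ℓ ^ k ℕ.∣ m ℕ.* n → ℓ ^ k ℕ.∣ n
prime-power-divisor _ _ ℕ.zero _ = ℕ.1∣ _
prime-power-divisor {ℓ} {m} {n} pℓ ℓ∤m (ℕ.suc k) ℓ^1+k∣mn
  with euclidsLemma m n pℓ (ℕ.∣-trans (ℕ.m∣m*n (ℓ ^ k)) ℓ^1+k∣mn)
... | inj₁ ℓ∣m = ⊥-elim (ℓ∤m ℓ∣m)
... | inj₂ (ℕ.divides q refl) =
  subst (ℓ ^ ℕ.suc k ℕ.∣_) (ℕ.*-comm ℓ q) (ℕ.*-monoʳ-∣ ℓ ℓ^k∣q)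
  where
  instance _ = prime⇒nonZero pℓ
  ℓ^k∣mq : ℓ ^ k ℕ.∣ m ℕ.* q
  ℓ^k∣mq = ℕ.*-cancelˡ-∣ ℓ (subst (ℓ ^ ℕ.suc k ℕ.∣_) (x∙yz≈z∙xy m q ℓ) ℓ^1+k∣mn)
  ℓ^k∣q : ℓ ^ k ℕ.∣ q
  ℓ^k∣q = prime-power-divisor pℓ ℓ∤m k ℓ^k∣mq

*-pres-∣ˢ : i ∣ˢ u → j ∣ˢ v → i * j ∣ˢ u * v
*-pres-∣ˢ {i} {j = j} (divides q refl) (divides r refl) =
  divides (q * r) (solve (q ∷ i ∷ r ∷ j ∷ []))

prime-power-divisorᶻ : Prime ℓ → ¬ + ℓ ∣ˢ u → ∀ k → + (ℓ ^ k) ∣ˢ u * v → + (ℓ ^ k) ∣ˢ v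
prime-power-divisorᶻ {ℓ} {u} {v} pℓ ℓ∤u k ℓ^k∣uv = ∣ᵤ⇒∣ {+ (ℓ ^ k)} {v}
  (prime-power-divisor pℓ (λ ℓ∣u → ℓ∤u (∣ᵤ⇒∣ {+ ℓ} {u} ℓ∣u)) k
    (subst (ℓ ^ k ℕ.∣_) (abs-* u v) (∣⇒∣ᵤ ℓ^k∣uv)))

prime-power-split : Prime ℓ → ¬ + ℓ ∣ˢ v - u → ∀ k →
  + (ℓ ^ k) ∣ˢ u * v → + (ℓ ^ k) ∣ˢ u ⊎ + (ℓ ^ k) ∣ˢ v
prime-power-split {ℓ} {v} {u} pℓ ℓ∤v-u k ℓ^k∣uv with + ℓ ∣ˢ? u
... | no  ℓ∤u = inj₂ (prime-power-divisorᶻ pℓ ℓ∤u k ℓ^k∣uv)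
... | yes ℓ∣u = inj₁ (prime-power-divisorᶻ pℓ ℓ∤v k (subst (_ ∣ˢ_) (*-comm u v) ℓ^k∣uv))
  where
  ℓ∤v : ¬ + ℓ ∣ˢ v
  ℓ∤v ℓ∣v = ℓ∤v-u (∣m∣n⇒∣m-n ℓ∣v ℓ∣u)

∣2x-a∧∣quadratic⇒∣discriminant : ∀ x a p → i ∣ˢ + 2 * x - a → i * i ∣ˢ x * x - a * x + p →
                                 i * i ∣ˢ a * a - + 4 * p
∣2x-a∧∣quadratic⇒∣discriminant {i} x a p i∣2x-a i²∣f = begin
  i * i                                                     ∣⟨ i²∣[2x-a]²-4f ⟩
  (+ 2 * x - a) * (+ 2 * x - a) - + 4 * (x * x - a * x + p) ≡⟨ solve (x ∷ a ∷ p ∷ []) ⟩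
  a * a - + 4 * p                                           ∎
  where
  open ∣-Reasoning
  i²∣[2x-a]²-4f : i * i ∣ˢ (+ 2 * x - a) * (+ 2 * x - a) - + 4 * (x * x - a * x + p)
  i²∣[2x-a]²-4f = ∣m∣n⇒∣m-n (*-pres-∣ˢ i∣2x-a i∣2x-a) (∣n⇒∣m*n (+ 4) i²∣f)

unit-∣-cancelˡ : ∀ ε → ε * ε ≡ + 1 → i ∣ˢ ε * j → i ∣ˢ j
unit-∣-cancelˡ {i} {j} ε ε²≡1 i∣εj = begin
  i               ∣⟨ ∣n⇒∣m*n ε i∣εj ⟩
  ε * (ε * j)     ≡⟨ *-assoc ε ε j ⟨
  ε * ε * j       ≡⟨ cong (_* j) ε²≡1 ⟩
  + 1 * j         ≡⟨ *-identityˡ j ⟩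
  j               ∎
  where open ∣-Reasoning

-- Modulo i, x ≡ ε gives 0 ≡ x² - a x + p ≡ ε² - a ε + 1 ≡ ε (2ε - a) ≡ ε (2x - a).
∣x-unit∧∣quadratic⇒∣2x-a : ∀ ε x a p → ε * ε ≡ + 1 → i ∣ˢ p - + 1 → i ∣ˢ x - ε →
                           i ∣ˢ x * x - a * x + p → i ∣ˢ + 2 * x - a
∣x-unit∧∣quadratic⇒∣2x-a {i} ε x a p ε²≡1 i∣p-1 i∣x-ε i∣f = unit-∣-cancelˡ ε ε²≡1 (begin
  i                                                                               ∣⟨ combination ⟩
  + 2 * ε * (x - ε) + (x * x - a * x + p) - (x - ε) * (x + ε - a) - (p - ε * ε) ≡⟨ solve (ε ∷ x ∷ a ∷ p ∷ []) ⟩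
  ε * (+ 2 * x - a)                                                               ∎)
  where
  open ∣-Reasoning
  i∣p-ε² : i ∣ˢ p - ε * ε
  i∣p-ε² = subst (λ e → i ∣ˢ p - e) (sym ε²≡1) i∣p-1
  combination : i ∣ˢ + 2 * ε * (x - ε) + (x * x - a * x + p) - (x - ε) * (x + ε - a) - (p - ε * ε)
  combination = ∣m∣n⇒∣m-n (∣m∣n⇒∣m-n (∣m∣n⇒∣m+n (∣n⇒∣m*n (+ 2 * ε) i∣x-ε) i∣f)
                                     (∣m⇒∣m*n (x + ε - a) i∣x-ε))
                          i∣p-ε²

∣x±1∧∣quadratic⇒∣discriminant : ∀ x a p → i ∣ˢ p - + 1 → i ∣ˢ x - + 1 ⊎ i ∣ˢ x + + 1 →
                                i * i ∣ˢ x * x - a * x + p → i * i ∣ˢ a * a - + 4 * p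
∣x±1∧∣quadratic⇒∣discriminant {i} x a p i∣p-1 x≡±1 i²∣f =
  ∣2x-a∧∣quadratic⇒∣discriminant x a p i∣2x-a i²∣f
  where
  i∣f : i ∣ˢ x * x - a * x + p
  i∣f = ∣-trans (∣m⇒∣m*n i (∣-refl {i})) i²∣f
  i∣2x-a : i ∣ˢ + 2 * x - a
  i∣2x-a = [ (λ i∣x-1 → ∣x-unit∧∣quadratic⇒∣2x-a (+ 1)   x a p refl i∣p-1 i∣x-1 i∣f)
           , (λ i∣x+1 → ∣x-unit∧∣quadratic⇒∣2x-a (- + 1) x a p refl i∣p-1 i∣x+1 i∣f) ] x≡±1

∃-half : ∀ a → + 2 ∣ˢ i + + 1 → ∃ λ x → i ∣ˢ + 2 * x - a
∃-half {i} a (divides h i+1≡2h) = a * h , divides a (begin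
  + 2 * (a * h) - a  ≡⟨ solve (a ∷ h ∷ []) ⟩
  a * (h * + 2) - a  ≡⟨ cong (λ t → a * t - a) i+1≡2h ⟨
  a * (i + + 1) - a  ≡⟨ solve (a ∷ i ∷ []) ⟩
  a * i              ∎)
  where open ≡-Reasoning

∣2x-a∧∣discriminant⇒∣4quadratic : ∀ x a p → i ∣ˢ + 2 * x - a → i ∣ˢ a * a - + 4 * p →
                                  i ∣ˢ + 4 * (x * x - a * x + p)
∣2x-a∧∣discriminant⇒∣4quadratic {i} x a p i∣2x-a i∣Δ = begin
  i                                                 ∣⟨ ∣m∣n⇒∣m-n (∣m⇒∣m*n (+ 2 * x - a) i∣2x-a) i∣Δ ⟩
  (+ 2 * x - a) * (+ 2 * x - a) - (a * a - + 4 * p) ≡⟨ solve (x ∷ a ∷ p ∷ []) ⟩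
  + 4 * (x * x - a * x + p)                         ∎
  where open ∣-Reasoning

∣discriminant⇒∣[a-2][a+2] : ∀ a p → i ∣ˢ a * a - + 4 * p → i ∣ˢ p - + 1 →
                            i ∣ˢ (a - + 2) * (a + + 2)
∣discriminant⇒∣[a-2][a+2] {i} a p i∣Δ i∣p-1 = begin
  i                                   ∣⟨ ∣m∣n⇒∣m+n i∣Δ (∣n⇒∣m*n (+ 4) i∣p-1) ⟩
  a * a - + 4 * p + + 4 * (p - + 1)   ≡⟨ solve (a ∷ p ∷ []) ⟩
  (a - + 2) * (a + + 2)               ∎
  where open ∣-Reasoning

∣2x-a∧∣a-2ε⇒∣2[x-ε] : ∀ x a ε → i ∣ˢ + 2 * x - a → i ∣ˢ a - + 2 * ε → i ∣ˢ + 2 * (x - ε)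
∣2x-a∧∣a-2ε⇒∣2[x-ε] {i} x a ε i∣2x-a i∣a-2ε = begin
  i                             ∣⟨ ∣m∣n⇒∣m+n i∣2x-a i∣a-2ε ⟩
  + 2 * x - a + (a - + 2 * ε)   ≡⟨ solve (x ∷ a ∷ ε ∷ []) ⟩
  + 2 * (x - ε)                 ∎
  where open ∣-Reasoning

+^-square : ∀ ℓ ν → + (ℓ ^ ν) * + (ℓ ^ ν) ≡ + (ℓ ^ (ν ℕ.+ ν))
+^-square ℓ ν = trans (sym (pos-* (ℓ ^ ν) (ℓ ^ ν))) (cong +_ (sym (ℕ.^-distribˡ-+-* ℓ ν ν)))

module OddPrimePower {ℓ : ℕ} (pℓ : Prime ℓ) (ℓ≢2 : ¬ ℓ ≡ 2) (ν : ℕ) where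

  d d² : ℤ
  d  = + (ℓ ^ ν)
  d² = d * d

  ℓ∤2 : ¬ + ℓ ∣ˢ + 2
  ℓ∤2 ℓ∣2 = prime≢2⇒∤2 pℓ ℓ≢2 (∣⇒∣ᵤ ℓ∣2)

  ℓ∤4 : ¬ + ℓ ∣ˢ + 4
  ℓ∤4 ℓ∣4 = prime∤⇒∤^ pℓ (prime≢2⇒∤2 pℓ ℓ≢2) 2 (∣⇒∣ᵤ ℓ∣4)

  2∣d²+1 : + 2 ∣ˢ d² + + 1
  2∣d²+1 = subst (λ e → + 2 ∣ˢ e + + 1) (sym (+^-square ℓ ν))
    (∣ᵤ⇒∣ (2∤⇒2∣+1 _ (prime∤⇒∤^ prime[2] (prime≢2⇒2∤ pℓ ℓ≢2) (ν ℕ.+ ν))))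

  d²-divisor : ∀ {u v} → ¬ + ℓ ∣ˢ u → d² ∣ˢ u * v → d² ∣ˢ v
  d²-divisor ℓ∤u d²∣uv = subst (_∣ˢ _) (sym (+^-square ℓ ν))
    (prime-power-divisorᶻ pℓ ℓ∤u (ν ℕ.+ ν) (subst (_∣ˢ _) (+^-square ℓ ν) d²∣uv))

  ∣2x-a⇒root : ∀ x a p → d ∣ˢ p - + 1 → d² ∣ˢ a * a - + 4 * p → d² ∣ˢ + 2 * x - a →
               (d ∣ˢ x - + 1 ⊎ d ∣ˢ x + + 1) × d² ∣ˢ x * x - a * x + p
  ∣2x-a⇒root x a p d∣p-1 d²∣Δ d²∣2x-a = x≡±1 , d²∣f
    where
    d∣d² : d ∣ˢ d²
    d∣d² = ∣m⇒∣m*n d (∣-refl {d})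
    d∣2x-a : d ∣ˢ + 2 * x - a
    d∣2x-a = ∣-trans d∣d² d²∣2x-a
    d²∣f : d² ∣ˢ x * x - a * x + p
    d²∣f = d²-divisor ℓ∤4 (∣2x-a∧∣discriminant⇒∣4quadratic x a p d²∣2x-a d²∣Δ)
    4≡[a+2]-[a-2] : + 4 ≡ (a + + 2) - (a - + 2)
    4≡[a+2]-[a-2] = solve (a ∷ [])
    d∣a∓2 : d ∣ˢ a - + 2 ⊎ d ∣ˢ a + + 2
    d∣a∓2 = prime-power-split pℓ (subst (λ e → ¬ + ℓ ∣ˢ e) 4≡[a+2]-[a-2] ℓ∤4) ν
              (∣discriminant⇒∣[a-2][a+2] a p (∣-trans d∣d² d²∣Δ) d∣p-1)
    x≡±1 : d ∣ˢ x - + 1 ⊎ d ∣ˢ x + + 1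
    x≡±1 = Sum.map
      (λ d∣a-2 → prime-power-divisorᶻ pℓ ℓ∤2 ν (∣2x-a∧∣a-2ε⇒∣2[x-ε] x a (+ 1) d∣2x-a d∣a-2))
      (λ d∣a+2 → prime-power-divisorᶻ pℓ ℓ∤2 ν (∣2x-a∧∣a-2ε⇒∣2[x-ε] x a (- + 1) d∣2x-a d∣a+2))
      d∣a∓2

  ∃-root : ∀ a p → d ∣ˢ p - + 1 → d² ∣ˢ a * a - + 4 * p →
          ∃ λ x → (d ∣ˢ x - + 1 ⊎ d ∣ˢ x + + 1) × d² ∣ˢ x * x - a * x + p
  ∃-root a p d∣p-1 d²∣Δ with ∃-half a 2∣d²+1
  ... | x , d²∣2x-a = x , ∣2x-a⇒root x a p d∣p-1 d²∣Δ d²∣2x-a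

lemma6p29 : (ℓ ν p : ℕ) (a : ℤ) → Prime ℓ → ¬ (ℓ ≡ 2) → ν ≥ 1 → Prime p →
    (+ (ℓ ^ ν)) ∣ (+ p - + 1) →
    (∃ λ (x : ℤ) → ((+ (ℓ ^ ν) ∣ (x - + 1)) ⊎ (+ (ℓ ^ ν) ∣ (x + + 1)))
                   × (+ (ℓ ^ ν) * + (ℓ ^ ν) ∣ (x * x - a * x + + p)))
    ⇔ (+ (ℓ ^ ν) * + (ℓ ^ ν) ∣ (a * a - + 4 * + p))
lemma6p29 ℓ ν p a pℓ ℓ≢2 _ _ d∣p-1 = mk⇔
  (λ (x , x≡±1 , d²∣f) → ∣⇒∣ᵤ (∣x±1∧∣quadratic⇒∣discriminant x a (+ p)
    (∣ᵤ⇒∣ {d} {+ p - + 1} d∣p-1)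
    (Sum.map (∣ᵤ⇒∣ {d} {x - + 1}) (∣ᵤ⇒∣ {d} {x + + 1}) x≡±1)
    (∣ᵤ⇒∣ {d²} {x * x - a * x + + p} d²∣f)))
  (λ d²∣Δ → Product.map₂ (Product.map (Sum.map ∣⇒∣ᵤ ∣⇒∣ᵤ) ∣⇒∣ᵤ)
    (∃-root a (+ p) (∣ᵤ⇒∣ {d} {+ p - + 1} d∣p-1) (∣ᵤ⇒∣ {d²} {a * a - + 4 * + p} d²∣Δ)))
  where open OddPrimePower pℓ ℓ≢2 ν
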